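{- If a connected graph $G$ contains a pan as an induced subgraph, then there is a DFS ordering of $G$ that is not a LexDFS ordering of $G$.
   Context: All graphs are finite and simple. For an ordering $\sigma$ of $V(G)$ write $x<_\sigma y$ if $x$ precedes $y$. $\sigma$ is a DFS ordering if whenever $a<_\sigma b<_\sigma c$, $ac\in E(G)$, $ab\notin E(G)$, there is $d$ with $a<_\sigma d<_\sigma b$ and $db\in E(G)$; it is a LexDFS ordering if under the same conditions there is $d$ with $a<_\sigma d<_\sigma b$, $db\in E(G)$ and $dc\notin E(G)$. For $k\ge3$ a $k$-pan is a $k$-cycle plus one extra vertex adjacent to exactly one cycle vertex; a pan is a $k$-pan for some $k\ge 3$. -}

module Defs where

open import Data.Nat using (ℕ; zero; suc; _≤_)
import Data.Nat as ℕ
open import Data.Fin using (Fin; toℕ; _<_)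
open import Data.Fin.Permutation using (Permutation′; _⟨$⟩ʳ_)
open import Data.Product using (Σ; ∃; _×_; _,_)
open import Data.Sum using (_⊎_)
open import Function.Definitions using (Injective)
open import Relation.Binary.PropositionalEquality using (_≡_)
open import Relation.Nullary using (¬_; Dec)

record Graph (n : ℕ) : Set₁ where
  field
    Adj   : Fin n → Fin n → Set
    adj?  : ∀ x y → Dec (Adj x y)
    sym   : ∀ {x y} → Adj x y → Adj y x
    irrefl : ∀ {x} → ¬ Adj x x
open Graph public

data Walk {n : ℕ} (G : Graph n) : Fin n → Fin n → Set where
  here  : ∀ {u} → Walk G u u
  there : ∀ {u w v} → Adj G u w → Walk G w v → Walk G u v

Connected : ∀ {n} → Graph n → Set
Connected G = ∀ u v → Walk G u v

-- A vertex ordering: π maps each vertex to its position in the ordering.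
Ordering : ℕ → Set
Ordering n = Permutation′ n

_<[_]_ : ∀ {n} → Fin n → Ordering n → Fin n → Set
x <[ π ] y = (π ⟨$⟩ʳ x) < (π ⟨$⟩ʳ y)

IsDFS : ∀ {n} (G : Graph n) → Ordering n → Set
IsDFS G π = ∀ a b c → a <[ π ] b → b <[ π ] c → Adj G a c → ¬ Adj G a b →
  ∃ λ d → a <[ π ] d × d <[ π ] b × Adj G d b

IsLexDFS : ∀ {n} (G : Graph n) → Ordering n → Set
IsLexDFS G π = ∀ a b c → a <[ π ] b → b <[ π ] c → Adj G a c → ¬ Adj G a b →
  ∃ λ d → a <[ π ] d × d <[ π ] b × Adj G d b × ¬ Adj G d c

-- Directed edge relation of the k-pan on vertices 0..k (as naturals):
-- cycle 0 - 1 - ... - (k-1) - 0, and pendant vertex k adjacent to 0 only.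
PanArc : ℕ → ℕ → ℕ → Set
PanArc k a b =
    (a ℕ.< k × b ℕ.< k × (suc a ≡ b ⊎ (suc a ≡ k × b ≡ 0)))
  ⊎ (a ≡ k × b ≡ 0)

PanAdj : (k : ℕ) → Fin (suc k) → Fin (suc k) → Set
PanAdj k i j = PanArc k (toℕ i) (toℕ j) ⊎ PanArc k (toℕ j) (toℕ i)

HasInducedPan : ∀ {n} → Graph n → ℕ → Set
HasInducedPan {n} G k = Σ (Fin (suc k) → Fin n) λ f →
  Injective _≡_ _≡_ f × (∀ i j → (Adj G (f i) (f j) → PanAdj k i j) × (PanAdj k i j → Adj G (f i) (f j)))

HasInducedPanSome : ∀ {n} → Graph n → Set
HasInducedPanSome G = ∃ λ k → 3 ≤ k × HasInducedPan G k

{-# OPTIONS --safe #-}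
-- Label the pan by the cycle 0, 1, …, s + 1 and the pendant k = s + 2 attached to 0. Search depth
-- first from s down the cycle to 0, step to the pendant, and finish the search arbitrarily: the
-- cycle vertex s + 1 then comes after the pendant. In the triple (s, pendant, s + 1), s + 1 is adjacent
-- to s but the pendant is not, and the only vertex in between adjacent to the pendant is 0, which is
-- also adjacent to s + 1; so the LexDFS condition fails. A DFS ordering is grown one position at a
-- time, each new vertex getting a parent after which every placed vertex is finished; connectivity
-- guarantees that such a next vertex exists until all vertices are placed.
module Submission where

open import Defs hiding (sym)
open import Data.Nat using (ℕ; zero; suc; _+_; _∸_; _≤_; _<_; z≤n; s≤s; s≤s⁻¹; _≤?_)
import Data.Nat as ℕ
open import Data.Nat.Properties hiding (_≟_)
open import Data.Fin using (Fin; toℕ; fromℕ<)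
open import Data.Fin.Properties using (toℕ-injective; toℕ-fromℕ<; toℕ<n; any?; _≟_)
open import Data.Fin.Permutation using (_⟨$⟩ʳ_; _⟨$⟩ˡ_; _∘ₚ_; transpose; inverseˡ; inverseʳ; id)
import Data.Fin.Permutation.Components as PC
open import Data.Product using (∃; _×_; _,_; proj₁; proj₂)
open import Data.Sum using (_⊎_; inj₁; inj₂)
open import Data.Empty using (⊥-elim)
open import Function using (_∘_; case_of_)
open import Function.Definitions using (Injective)
open import Relation.Nullary using (¬_; yes; no; contradiction)
open import Relation.Nullary.Decidable using (_×-dec_)
open import Relation.Binary.PropositionalEquality
  using (_≡_; _≢_; refl; sym; trans; cong; subst; subst₂)
open import Relation.Binary.Definitions using (tri<; tri≈; tri>)

transpose-matchˡ : ∀ {n} (i j : Fin n) → PC.transpose i j i ≡ j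
transpose-matchˡ i j with i ≟ i
... | yes _   = refl
... | no i≢i = contradiction refl i≢i

transpose-fixesBelow : ∀ {n m} (p i : Fin n) → toℕ i ≡ m → m ≤ toℕ p →
  ∀ k → toℕ k < m ⊎ toℕ (PC.transpose p i k) < m → PC.transpose p i k ≡ k
transpose-fixesBelow p i i≡m m≤p k below with k ≟ p
... | yes refl = ⊥-elim (case below)
  where
  case : ¬ (toℕ k < _ ⊎ toℕ i < _)
  case (inj₁ k<m) = <⇒≱ k<m m≤p
  case (inj₂ i<m) = <-irrefl i≡m i<m
... | no _ with k ≟ i
...   | yes refl = ⊥-elim (case below)
  where
  case : ¬ (toℕ k < _ ⊎ toℕ p < _)
  case (inj₁ k<m) = <-irrefl i≡m k<m
  case (inj₂ p<m) = <⇒≱ p<m m≤p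
...   | no _ = refl

module DFSPrefix {n : ℕ} (G : Graph n) where

  position : Ordering n → Fin n → ℕ
  position π x = toℕ (π ⟨$⟩ʳ x)

  position-injective : ∀ π {x y} → position π x ≡ position π y → x ≡ y
  position-injective π {x} {y} eq = trans (sym (inverseˡ π))
    (trans (cong (π ⟨$⟩ˡ_) (toℕ-injective eq)) (inverseˡ π))

  position-⟨$⟩ˡ : ∀ π i → position π (π ⟨$⟩ˡ i) ≡ toℕ i
  position-⟨$⟩ˡ π i = cong toℕ (inverseʳ π)

  record AgreeBelow (m : ℕ) (π π′ : Ordering n) : Set where
    constructor agreeBelow
    field
      agree : ∀ x → position π x < m ⊎ position π′ x < m → position π′ x ≡ position π x

  open AgreeBelow

  agreeBelow-refl : ∀ {m π} → AgreeBelow m π π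
  agreeBelow-refl = agreeBelow λ _ _ → refl

  agreeBelow-weaken : ∀ {m m′ π π′} → m ≤ m′ → AgreeBelow m′ π π′ → AgreeBelow m π π′
  agreeBelow-weaken m≤m′ A = agreeBelow λ where
    x (inj₁ p) → agree A x (inj₁ (<-≤-trans p m≤m′))
    x (inj₂ p) → agree A x (inj₂ (<-≤-trans p m≤m′))

  agreeBelow-trans : ∀ {m π₁ π₂ π₃} → AgreeBelow m π₁ π₂ → AgreeBelow m π₂ π₃ → AgreeBelow m π₁ π₃
  agreeBelow-trans {m} {π₁} {π₂} {π₃} A B = agreeBelow λ x below →
    trans (agree B x (left x below)) (agree A x (right x below))
    where
    left : ∀ x → position π₁ x < m ⊎ position π₃ x < m → position π₂ x < m ⊎ position π₃ x < m
    left x (inj₁ p) = inj₁ (subst (_< m) (sym (agree A x (inj₁ p))) p)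
    left x (inj₂ p) = inj₂ p
    right : ∀ x → position π₁ x < m ⊎ position π₃ x < m → position π₁ x < m ⊎ position π₂ x < m
    right x (inj₁ p) = inj₁ p
    right x (inj₂ p) = inj₂ (subst (_< m) (agree B x (inj₂ p)) p)

  agreeBelow-positions : ∀ {m π π′} (V : ℕ → Fin n) → AgreeBelow m π π′ →
    (∀ {i} → i < m → position π (V i) ≡ i) → ∀ {i} → i < m → position π′ (V i) ≡ i
  agreeBelow-positions V A P i<m = trans (agree A (V _) (inj₁ (subst (_< _) (sym (P i<m)) i<m))) (P i<m)

  -- The search backtracks to the parent before discovering w: every vertex after it is finished.
  record ParentAt (π : Ordering n) (m : ℕ) (w : Fin n) : Set where
    constructor parentAt
    field
      parent   : Fin n
      parent<  : position π parent < m
      parent~w : Adj G parent w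
      closed   : ∀ e c → position π parent < position π e → position π e < m →
                 Adj G e c → position π c < m

  DFSPrefix : ℕ → Ordering n → Set
  DFSPrefix m π = ∀ b → 0 < position π b → position π b < m → ParentAt π (position π b) b

  parentAt-agree : ∀ {m π π′ w} → AgreeBelow m π π′ → ParentAt π m w → ParentAt π′ m w
  parentAt-agree {m} {π} {π′} A (parentAt d d<m dw closed) =
    parentAt d (subst (_< m) (sym d≡) d<m) dw closed′
    where
    d≡ : position π′ d ≡ position π d
    d≡ = agree A d (inj₁ d<m)
    closed′ : ∀ e c → position π′ d < position π′ e → position π′ e < m → Adj G e c → position π′ c < m
    closed′ e c d<e e<m ec = subst (_< m) (sym (agree A c (inj₁ c<m))) c<m
      where
      e≡ = agree A e (inj₂ e<m)
      c<m = closed e c (subst₂ _<_ d≡ e≡ d<e) (subst (_< m) e≡ e<m) ec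

  parentAt-predecessor : ∀ {m π d w} → position π d ≡ m → Adj G d w → ParentAt π (suc m) w
  parentAt-predecessor {m} d≡m dw = parentAt _ (s≤s (≤-reflexive d≡m)) dw
    λ e c d<e e<sm _ → ⊥-elim (<⇒≱ (subst (_< _) d≡m d<e) (s≤s⁻¹ e<sm))

  moveTo : ∀ {m} π w → m ≤ position π w → ∃ λ π′ → AgreeBelow m π π′ × position π′ w ≡ m
  moveTo {m} π w m≤w =
    π ∘ₚ transpose (π ⟨$⟩ʳ w) i ,
    agreeBelow (λ x → cong toℕ ∘ transpose-fixesBelow (π ⟨$⟩ʳ w) i i≡m m≤w (π ⟨$⟩ʳ x)) ,
    trans (cong toℕ (transpose-matchˡ (π ⟨$⟩ʳ w) i)) i≡m
    where
    m<n : m < n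
    m<n = ≤-<-trans m≤w (toℕ<n _)
    i = fromℕ< m<n
    i≡m = toℕ-fromℕ< m<n

  dfsPrefix-extend : ∀ {m π w} → DFSPrefix m π → m ≤ position π w → (0 < m → ParentAt π m w) →
    ∃ λ π′ → DFSPrefix (suc m) π′ × AgreeBelow m π π′ × position π′ w ≡ m
  dfsPrefix-extend {m} {π} {w} D m≤w parent with moveTo π w m≤w
  ... | π′ , A , w≡m = π′ , D′ , A , w≡m
    where
    D′ : DFSPrefix (suc m) π′
    D′ b 0<b b<sm with m≤n⇒m<n∨m≡n (s≤s⁻¹ b<sm)
    ... | inj₁ b<m = subst (λ p → ParentAt π′ p b) (sym b≡)
      (parentAt-agree (agreeBelow-weaken (<⇒≤ (subst (_< m) b≡ b<m)) A)
        (D b (subst (0 <_) b≡ 0<b) (subst (_< m) b≡ b<m)))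
      where b≡ = agree A b (inj₂ b<m)
    ... | inj₂ b≡m with position-injective π′ (trans b≡m (sym w≡m))
    ...   | refl = subst (λ p → ParentAt π′ p b) (sym b≡m)
                     (parentAt-agree A (parent (subst (0 <_) b≡m 0<b)))

  dfsPrefix⇒IsDFS : ∀ {π} → DFSPrefix n π → IsDFS G π
  dfsPrefix⇒IsDFS {π} D a b c a<b b<c ac ¬ab
    with D b (≤-<-trans z≤n a<b) (toℕ<n _)
  ... | parentAt d d<b db closed with <-cmp (position π d) (position π a)
  ... | tri< d<a _ _ = ⊥-elim (<-asym (closed a c d<a a<b ac) b<c)
  ... | tri≈ _ d≡a _ = ⊥-elim (¬ab (subst (λ z → Adj G z b) (position-injective π d≡a) db))
  ... | tri> _ _ a<d = d , a<d , d<b , db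

  positioned-below : ∀ {m π} (V : ℕ → Fin n) → (∀ {i} → i < m → position π (V i) ≡ i) →
    ∀ {x} → position π x < m → V (position π x) ≡ x
  positioned-below {π = π} V P x<m = position-injective π (P x<m)

  outside-prefix : ∀ {m π w} (V : ℕ → Fin n) → (∀ {i} → i < m → position π (V i) ≡ i) →
    (∀ {i} → i < m → V i ≢ w) → m ≤ position π w
  outside-prefix {m} {π} {w} V P V≢w with m ≤? position π w
  ... | yes m≤w = m≤w
  ... | no m≰w = contradiction (positioned-below {π = π} V P (≰⇒> m≰w)) (V≢w (≰⇒> m≰w))

  parentAt-path : ∀ {L π} (V : ℕ → Fin n) → (∀ {i} → i < L → position π (V i) ≡ i) →
    (∀ {i} → suc i ≤ L → Adj G (V i) (V (suc i))) → 0 < L → ParentAt π L (V L)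
  parentAt-path {suc L} V P V-adj _ = parentAt-predecessor (P ≤-refl) (V-adj ≤-refl)

  dfsPrefix-path : ∀ L (V : ℕ → Fin n) → (∀ {i j} → i < L → j < L → V i ≡ V j → i ≡ j) →
    (∀ {i} → suc i < L → Adj G (V i) (V (suc i))) →
    ∃ λ π → DFSPrefix L π × (∀ {i} → i < L → position π (V i) ≡ i)
  dfsPrefix-path zero V _ _ = id , (λ _ _ ()) , λ ()
  dfsPrefix-path (suc L) V V-inj V-adj
    with dfsPrefix-path L V (λ i<L j<L → V-inj (m<n⇒m<1+n i<L) (m<n⇒m<1+n j<L)) (V-adj ∘ m<n⇒m<1+n)
  ... | π , D , P
    with dfsPrefix-extend D (outside-prefix {π = π} V P λ i<L → <⇒≢ i<L ∘ V-inj (m<n⇒m<1+n i<L) ≤-refl)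
                             (parentAt-path V P (V-adj ∘ s≤s))
  ... | π′ , D′ , A , V≡L = π′ , D′ , P′
    where
    P′ : ∀ {i} → i < suc L → position π′ (V i) ≡ i
    P′ i<sL with m≤n⇒m<n∨m≡n (s≤s⁻¹ i<sL)
    ... | inj₁ i<L = agreeBelow-positions V A P i<L
    ... | inj₂ refl = V≡L

  ClosedBelow : ℕ → Ordering n → Set
  ClosedBelow m π = ∀ e c → position π e < m → Adj G e c → position π c < m

  closedBelow-walk : ∀ {m π x y} → ClosedBelow m π → Walk G x y → position π x < m → position π y < m
  closedBelow-walk C here x<m = x<m
  closedBelow-walk {π = π} C (there xz walk) x<m = closedBelow-walk {π = π} C walk (C _ _ x<m xz)

  connected⇒¬closedBelow : ∀ {m} π → Connected G → 0 < m → m < n → ¬ ClosedBelow m π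
  connected⇒¬closedBelow {m} π conn 0<m m<n C =
    <-irrefl (vertexAt≡ m<n)
      (closedBelow-walk {π = π} C (conn (vertexAt 0<n) (vertexAt m<n))
        (subst (_< m) (sym (vertexAt≡ 0<n)) 0<m))
    where
    0<n = <-trans 0<m m<n
    vertexAt : ∀ {j} → j < n → Fin n
    vertexAt j<n = π ⟨$⟩ˡ fromℕ< j<n
    vertexAt≡ : ∀ {j} (j<n : j < n) → position π (vertexAt j<n) ≡ j
    vertexAt≡ j<n = trans (position-⟨$⟩ˡ π (fromℕ< j<n)) (toℕ-fromℕ< j<n)

  -- Scanning positions downwards from m, the first vertex with a neighbour at position m or
  -- later is the parent of that neighbour; if there is none, the prefix is closed.
  parentAt⊎closedBelow : ∀ m π → (∃ λ w → m ≤ position π w × ParentAt π m w) ⊎ ClosedBelow m π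
  parentAt⊎closedBelow m π = scan m ≤-refl λ e c m≤e e<m → contradiction m≤e (<⇒≱ e<m)
    where
    scan : ∀ j → j ≤ m → (∀ e c → j ≤ position π e → position π e < m → Adj G e c → position π c < m) →
      (∃ λ w → m ≤ position π w × ParentAt π m w) ⊎ ClosedBelow m π
    scan zero _ closed = inj₂ λ e c → closed e c z≤n
    scan (suc j) j<m closed
      with any? (λ d → (position π d ℕ.≟ j) ×-dec any? (λ c → adj? G d c ×-dec (m ≤? position π c)))
    ... | yes (d , refl , c , dc , m≤c) = inj₁ (c , m≤c , parentAt d j<m dc closed)
    ... | no none = scan j (<⇒≤ j<m) closed′
      where
      closed′ : ∀ e c → j ≤ position π e → position π e < m → Adj G e c → position π c < m
      closed′ e c j≤e e<m ec with m≤n⇒m<n∨m≡n j≤e | m ≤? position π c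
      ... | inj₁ j<e | _ = closed e c j<e e<m ec
      ... | inj₂ j≡e | yes m≤c = contradiction (e , sym j≡e , c , ec , m≤c) none
      ... | inj₂ _ | no m≰c = ≰⇒> m≰c

  dfsPrefix-complete : Connected G → ∀ r {m π} → r + m ≡ n → 0 < m → DFSPrefix m π →
    ∃ λ π′ → DFSPrefix n π′ × AgreeBelow m π π′
  dfsPrefix-complete conn zero {π = π} refl _ D = π , D , agreeBelow-refl
  dfsPrefix-complete conn (suc r) {m} {π} r+m≡n 0<m D with parentAt⊎closedBelow m π
  ... | inj₂ closed = contradiction closed (connected⇒¬closedBelow π conn 0<m m<n)
    where
    m<n : m < n
    m<n = subst (m <_) r+m≡n (s≤s (m≤n+m m r))
  ... | inj₁ (w , m≤w , parent) with dfsPrefix-extend D m≤w (λ _ → parent)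
  ... | π₁ , D₁ , A₁ , _ with dfsPrefix-complete conn r (trans (+-suc r m) r+m≡n) (s≤s z≤n) D₁
  ... | π₂ , D₂ , A₂ = π₂ , D₂ , agreeBelow-trans A₁ (agreeBelow-weaken (n≤1+n m) A₂)

  violation⇒¬IsLexDFS : ∀ {π} a b c → a <[ π ] b → b <[ π ] c → Adj G a c → ¬ Adj G a b →
    (∀ d → a <[ π ] d → d <[ π ] b → Adj G d b → Adj G d c) → ¬ IsLexDFS G π
  violation⇒¬IsLexDFS a b c a<b b<c ac ¬ab neighbours lex with lex a b c a<b b<c ac ¬ab
  ... | d , a<d , d<b , db , ¬dc = ¬dc (neighbours d a<d d<b db)

module InducedPan {n : ℕ} (G : Graph n) (t : ℕ)
  (f : Fin (suc (suc (suc (suc t)))) → Fin n) (f-injective : Injective _≡_ _≡_ f)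
  (f-induced : ∀ i j → (Adj G (f i) (f j) → PanAdj (suc (suc (suc t))) i j) ×
                       (PanAdj (suc (suc (suc t))) i j → Adj G (f i) (f j))) where

  open DFSPrefix G

  s k : ℕ
  s = suc t
  k = suc (suc s)

  PanEdge : ℕ → ℕ → Set
  PanEdge i j = PanArc k i j ⊎ PanArc k j i

  labels-injective : ∀ {i j x y} → toℕ i ≡ x → toℕ j ≡ y → f i ≡ f j → x ≡ y
  labels-injective refl refl eq = cong toℕ (f-injective eq)

  edge⇒adj : ∀ {i j x y} → toℕ i ≡ x → toℕ j ≡ y → PanEdge x y → Adj G (f i) (f j)
  edge⇒adj refl refl = proj₂ (f-induced _ _)

  adj⇒edge : ∀ {i j x y} → toℕ i ≡ x → toℕ j ≡ y → Adj G (f i) (f j) → PanEdge x y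
  adj⇒edge refl refl = proj₁ (f-induced _ _)

  pendant-edge : ∀ {i} → PanEdge i k → i ≡ 0
  pendant-edge (inj₁ (inj₁ (_ , k<k , _))) = contradiction k<k (<-irrefl refl)
  pendant-edge (inj₂ (inj₁ (k<k , _))) = contradiction k<k (<-irrefl refl)
  pendant-edge (inj₂ (inj₂ (_ , i≡0))) = i≡0

  zero-pendant : ∀ {i} → i ≡ 0 → PanEdge i k
  zero-pendant refl = inj₂ (inj₂ (refl , refl))

  zero-omitted : ∀ {i} → i ≡ 0 → PanEdge i (suc s)
  zero-omitted refl = inj₂ (inj₁ (≤-refl , s≤s z≤n , inj₂ (refl , refl)))

  ∸<k : ∀ j → s ∸ j < k
  ∸<k j = s≤s (≤-trans (m∸n≤m s j) (n≤1+n s))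

  cycleLabel : ℕ → Fin (suc k)
  cycleLabel j = fromℕ< (m<n⇒m<1+n (∸<k j))

  pendantLabel omittedLabel : Fin (suc k)
  pendantLabel = fromℕ< ≤-refl
  omittedLabel = fromℕ< (m<n⇒m<1+n ≤-refl)

  toℕ-cycleLabel : ∀ j → toℕ (cycleLabel j) ≡ s ∸ j
  toℕ-cycleLabel j = toℕ-fromℕ< (m<n⇒m<1+n (∸<k j))

  toℕ-pendantLabel : toℕ pendantLabel ≡ k
  toℕ-pendantLabel = toℕ-fromℕ< ≤-refl

  toℕ-omittedLabel : toℕ omittedLabel ≡ suc s
  toℕ-omittedLabel = toℕ-fromℕ< (m<n⇒m<1+n ≤-refl)

  cycle : ℕ → Fin n
  cycle j = f (cycleLabel j)

  pendant omitted : Fin n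
  pendant = f pendantLabel
  omitted = f omittedLabel

  cycle-injective : ∀ {i j} → i < suc s → j < suc s → cycle i ≡ cycle j → i ≡ j
  cycle-injective {i} {j} i<s j<s eq = ∸-cancelˡ-≡ (s≤s⁻¹ i<s) (s≤s⁻¹ j<s)
    (labels-injective (toℕ-cycleLabel i) (toℕ-cycleLabel j) eq)

  cycle-adj : ∀ {j} → suc j < suc s → Adj G (cycle j) (cycle (suc j))
  cycle-adj {j} sj<ss = edge⇒adj (toℕ-cycleLabel j) (toℕ-cycleLabel (suc j))
    (inj₂ (inj₁ (∸<k (suc j) , ∸<k j , inj₁ (sym (+-∸-assoc 1 (s≤s⁻¹ sj<ss))))))

  pendant≢cycle : ∀ j → pendant ≢ cycle j
  pendant≢cycle j eq = <-irrefl (sym (labels-injective toℕ-pendantLabel (toℕ-cycleLabel j) eq)) (∸<k j)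

  omitted≢cycle : ∀ j → omitted ≢ cycle j
  omitted≢cycle j eq =
    <-irrefl (sym (labels-injective toℕ-omittedLabel (toℕ-cycleLabel j) eq)) (s≤s (m∸n≤m s j))

  omitted≢pendant : omitted ≢ pendant
  omitted≢pendant eq = <-irrefl (labels-injective toℕ-omittedLabel toℕ-pendantLabel eq) ≤-refl

  cycle-end~pendant : Adj G (cycle s) pendant
  cycle-end~pendant = edge⇒adj (toℕ-cycleLabel s) toℕ-pendantLabel (zero-pendant (n∸n≡0 s))

  start~omitted : Adj G (cycle 0) omitted
  start~omitted = edge⇒adj (toℕ-cycleLabel 0) toℕ-omittedLabel
    (inj₁ (inj₁ (m<n⇒m<1+n ≤-refl , ≤-refl , inj₁ refl)))

  start≁pendant : ¬ Adj G (cycle 0) pendant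
  start≁pendant a with pendant-edge (adj⇒edge (toℕ-cycleLabel 0) toℕ-pendantLabel a)
  ... | ()

  cycle~pendant⇒cycle~omitted : ∀ j → Adj G (cycle j) pendant → Adj G (cycle j) omitted
  cycle~pendant⇒cycle~omitted j a = edge⇒adj (toℕ-cycleLabel j) toℕ-omittedLabel
    (zero-omitted (pendant-edge (adj⇒edge (toℕ-cycleLabel j) toℕ-pendantLabel a)))

  PanPlaced : Ordering n → Set
  PanPlaced π = (∀ {i} → i < suc s → position π (cycle i) ≡ i) × position π pendant ≡ suc s

  extendByPendant : ∀ {π₀} → DFSPrefix (suc s) π₀ → (∀ {i} → i < suc s → position π₀ (cycle i) ≡ i) →
    ∃ λ π → DFSPrefix k π × AgreeBelow (suc s) π₀ π × position π pendant ≡ suc s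
  extendByPendant {π₀} D₀ P₀ =
    dfsPrefix-extend {π = π₀} D₀ (outside-prefix {π = π₀} cycle P₀ (λ {i} _ → pendant≢cycle i ∘ sym))
                                 (λ _ → parentAt-predecessor (P₀ ≤-refl) cycle-end~pendant)

  panPrefix : ∃ λ π → DFSPrefix k π × PanPlaced π
  panPrefix = case dfsPrefix-path (suc s) cycle cycle-injective cycle-adj of λ where
    (π₀ , D₀ , P₀) → case extendByPendant D₀ P₀ of λ where
      (π , D , A , pendant≡) → π , D , (λ {i} → agreeBelow-positions cycle A P₀ {i}) , pendant≡

  panPlaced-agree : ∀ {π π′} → AgreeBelow k π π′ → PanPlaced π → PanPlaced π′
  panPlaced-agree A (P , pendant≡) =
    agreeBelow-positions cycle (agreeBelow-weaken (n≤1+n _) A) P ,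
    trans (AgreeBelow.agree A pendant (inj₁ (subst (_< k) (sym pendant≡) ≤-refl))) pendant≡

  dfs-¬lexDFS-from : ∀ π → DFSPrefix n π → PanPlaced π → IsDFS G π × ¬ IsLexDFS G π
  dfs-¬lexDFS-from π D (P , pendant≡) = dfsPrefix⇒IsDFS D ,
    violation⇒¬IsLexDFS {π} (cycle 0) pendant omitted
      start<pendant pendant<omitted start~omitted start≁pendant neighbours
    where
    start<pendant : position π (cycle 0) < position π pendant
    start<pendant = subst₂ _<_ (sym (P (s≤s z≤n))) (sym pendant≡) (s≤s z≤n)
    pendant<omitted : position π pendant < position π omitted
    pendant<omitted = subst (_< position π omitted) (sym pendant≡)
      (≤∧≢⇒< (outside-prefix {π = π} cycle P (λ {i} _ → omitted≢cycle i ∘ sym))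
        λ eq → omitted≢pendant (position-injective π (trans (sym eq) (sym pendant≡))))
    neighbours : ∀ d → position π (cycle 0) < position π d → position π d < position π pendant →
      Adj G d pendant → Adj G d omitted
    neighbours d _ d<pendant d~pendant =
      subst (λ x → Adj G x omitted) on-cycle
        (cycle~pendant⇒cycle~omitted (position π d)
          (subst (λ x → Adj G x pendant) (sym on-cycle) d~pendant))
      where
      on-cycle = positioned-below {π = π} cycle P (subst (position π d <_) pendant≡ d<pendant)

  completePanPrefix : Connected G → ∀ {π₀} → DFSPrefix k π₀ → position π₀ pendant ≡ suc s →
    ∃ λ π → DFSPrefix n π × AgreeBelow k π₀ π
  completePanPrefix conn {π₀} D₀ pendant≡ = dfsPrefix-complete conn (n ∸ k) {k} {π₀}
    (m∸n+n≡m (subst (_< n) pendant≡ (toℕ<n (π₀ ⟨$⟩ʳ pendant)))) (s≤s z≤n) D₀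

  dfs-¬lexDFS : Connected G → ∃ λ π → IsDFS G π × ¬ IsLexDFS G π
  dfs-¬lexDFS conn = case panPrefix of λ where
    (π₀ , D₀ , placed₀) → case completePanPrefix conn D₀ (proj₂ placed₀) of λ where
      (π , D , A) → π , dfs-¬lexDFS-from π D (panPlaced-agree A placed₀)

lemma6 : ∀ {n : ℕ} (G : Graph n) → Connected G → HasInducedPanSome G →
    ∃ λ (π : Ordering n) → IsDFS G π × ¬ IsLexDFS G π
lemma6 G conn (suc (suc (suc t)) , s≤s (s≤s (s≤s _)) , f , f-injective , f-induced) =
  InducedPan.dfs-¬lexDFS G t f f-injective f-induced conn
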